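{- Let $n\in\mathbb N$, $0\le r<n-1$, $s=\lfloor r/2\rfloor$ and $q\in W(n,r+1)$. Then $f(i,q)\in W(n,r)$ for all $1\le i\le s+1$, and $g(i,q)\in W(n,r)$ for all $1\le i\le s$ and, if $r$ is odd, also for $i=s+1$.
   Context: $\mathcal{NC}(0,n)$ is the set of non-crossing partitions of $\{1,\dots,n\}$. For $0\le r<n$ with $s=\lfloor r/2\rfloor$: if $r=2s$, $W(n,r)$ is the set of $p\in\mathcal{NC}(0,n)$ in which none of $1,\dots,s$ is a singleton and $1,\dots,s+1$ lie in pairwise different blocks; if $r=2s+1$, $W(n,r)$ is the set of $p$ in which none of $1,\dots,s+1$ is a singleton and they lie in pairwise different blocks. For $q\in W(n,r+1)$ let $X(j)$ denote the block of $q$ containing $j$ and $K(j)=X(j)\setminus\{j\}$ (these are non-empty and pairwise disjoint for $1\le j\le s+1$, and also disjoint from $X(s+2)$ when $r$ is odd). For $1\le i\le s+1$, $f(i,q)$ is the partition obtained from $q$ by replacing the blocks $X(j)$ ($i\le j\le s+1$), and for odd $r$ also $X(s+2)$, by: $K(i)$; $\{j\}\cup K(j+1)$ for $i\le j\le s$; and $\{s+1\}$ if $r$ is even, resp. $\{s+1\}\cup X(s+2)$ if $r$ is odd (all other blocks of $q$ unchanged). For $1\le i\le s$, $g(i,q)$ is obtained from $q$ by replacing the blocks $X(j)$ ($i\le j\le s+1$), and for odd $r$ also $X(s+2)$, by: $\{i\}\cup K(i)\cup K(i+1)$; $\{j\}\cup K(j+1)$ for $i<j\le s$; and $\{s+1\}$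 if $r$ is even, resp. $\{s+1\}\cup X(s+2)$ if $r$ is odd. If $r$ is odd, $g(s+1,q)$ is obtained from $q$ by merging the blocks $X(s+1)$ and $X(s+2)$. -}

module Defs where

open import Data.Nat using (ℕ; zero; suc; _+_; _∸_; _≤_; _<_; _≡ᵇ_; _≤ᵇ_; _/_; _%_)
open import Data.Bool using (Bool; true; false; if_then_else_; _∧_)
open import Data.Maybe using (Maybe; just; nothing)
open import Data.Product using (_×_)
open import Relation.Binary.PropositionalEquality using (_≡_; _≢_)

-- A set partition p of {1,…,n} is represented by a block-labelling
-- p : ℕ → L (only the values on 1..n matter): x and y lie in the same
-- block of p iff p x ≡ p y.

NonCrossing : {L : Set} → ℕ → (ℕ → L) → Set
NonCrossing n p = ∀ a b c d → 1 ≤ a → a < b → b < c → c < d → d ≤ n →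
  p a ≡ p c → p b ≡ p d → p a ≡ p b

Singleton : {L : Set} → ℕ → (ℕ → L) → ℕ → Set
Singleton n p x = ∀ y → 1 ≤ y → y ≤ n → p y ≡ p x → y ≡ x

-- W(n,r), s = ⌊r/2⌋:
--  r = 2s   : none of 1..s singleton,   1..s+1 pairwise different blocks
--  r = 2s+1 : none of 1..s+1 singleton, 1..s+1 pairwise different blocks
-- i.e. the non-singleton bound is s + (r mod 2), the distinctness bound s+1.
W : {L : Set} → ℕ → ℕ → (ℕ → L) → Set
W n r p =
  NonCrossing n p
  × (∀ j → 1 ≤ j → j ≤ r / 2 + r % 2 → Singleton n p j → Data.Empty.⊥)
  × (∀ j k → 1 ≤ j → j < k → k ≤ r / 2 + 1 → p j ≢ p k)
  where import Data.Empty

-- labels of the new partitions: old blocks keep their label (old ℓ),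
-- newly formed blocks get labels (new m)
data Tag : Set where
  old : ℕ → Tag
  new : ℕ → Tag

-- least j with lo ≤ j ≤ lo + k and q x = q j (i.e. x ∈ X(j))
findBlock : (ℕ → ℕ) → ℕ → ℕ → ℕ → Maybe ℕ
findBlock q x lo zero = if q x ≡ᵇ q lo then just lo else nothing
findBlock q x lo (suc k) =
  if q x ≡ᵇ q lo then just lo else findBlock q x (suc lo) k

blockIn : (ℕ → ℕ) → ℕ → ℕ → ℕ → Maybe ℕ
blockIn q s i x = findBlock q x i ((s + 1) ∸ i)

isOdd : ℕ → Bool
isOdd r = r % 2 ≡ᵇ 1

-- f(i,q) (w.r.t. r, s = ⌊r/2⌋).  Labels of new blocks:
--   new 0           : K(i)
--   new j (i≤j≤s)   : {j} ∪ K(j+1)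
--   new (s+1)       : {s+1}   (r even)  resp. {s+1} ∪ X(s+2) (r odd)
f : ℕ → ℕ → (ℕ → ℕ) → ℕ → Tag
f r i q x with blockIn q (r / 2) i x
... | just j = if x ≡ᵇ j then new j
               else (if j ≡ᵇ i then new 0 else new (j ∸ 1))
... | nothing = if isOdd r ∧ (q x ≡ᵇ q (r / 2 + 2)) then new (r / 2 + 1)
                else old (q x)

-- g(i,q) for 1 ≤ i ≤ s.  Labels of new blocks:
--   new i           : {i} ∪ K(i) ∪ K(i+1)
--   new j (i<j≤s)   : {j} ∪ K(j+1)
--   new (s+1)       : {s+1}   (r even)  resp. {s+1} ∪ X(s+2) (r odd)
gLow : ℕ → ℕ → (ℕ → ℕ) → ℕ → Tag
gLow r i q x with blockIn q (r / 2) i x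
... | just j = if x ≡ᵇ j then new j
               else (if j ≡ᵇ i then new i else new (j ∸ 1))
... | nothing = if isOdd r ∧ (q x ≡ᵇ q (r / 2 + 2)) then new (r / 2 + 1)
                else old (q x)

-- g(s+1,q) for odd r: merge X(s+1) and X(s+2)
gTop : ℕ → (ℕ → ℕ) → ℕ → Tag
gTop r q x = if q x ≡ᵇ q (r / 2 + 2) then old (q (r / 2 + 1)) else old (q x)

g : ℕ → ℕ → (ℕ → ℕ) → ℕ → Tag
g r i q = if i ≤ᵇ r / 2 then gLow r i q else gTop r q

module Submission where

-- A partition is a labelling of {1,…,n}, and W(n,r) only depends on which
-- points share a label (W-resp).  With s = ⌊r/2⌋, t = ⌈r/2⌉ and τ the map
-- moving the interval [i,t] one step to the right, f(i,q) is a relabelling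
-- of the "model" q ∘ τ in which s+1 is made a singleton when r is even;
-- g(i,q) for i ≤ s is the same relabelling of the model of q with the blocks
-- of i and i+1 merged, and g(s+1,q) (r odd) is q with the blocks of s+1 and
-- s+2 merged.

open import Defs
open import Data.Nat using (ℕ; zero; suc; _+_; _∸_; _≤_; _<_; _/_; _%_; _≡ᵇ_; z≤n; s≤s; _≟_; _≤?_; _<?_)
open import Data.Nat.Properties
open import Data.Nat.DivMod using (m%n<n; [m+n]%n≡m%n; m/n≡1+[m∸n]/n; m/n≤m)
open import Data.Bool using (Bool; true; false; if_then_else_; _∧_; not; T)
open import Data.Bool.Properties using (∧-zeroʳ; ∧-conicalˡ; ∧-conicalʳ)
open import Data.Maybe using (Maybe; just; nothing; maybe′)
open import Data.Maybe.Properties using (just-injective)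
open import Data.Product using (_×_; _,_; ∃; proj₁; proj₂)
open import Data.Sum using (_⊎_; inj₁; inj₂; [_,_]′)
open import Data.Empty using (⊥; ⊥-elim)
open import Relation.Nullary using (¬_; Dec; yes; no; proof)
open import Relation.Nullary.Decidable using (dec-true; dec-false; _×-dec_; _⊎-dec_; ¬?)
open import Relation.Nullary.Reflects using (Reflects; ofʸ; ofⁿ)
open import Relation.Binary.PropositionalEquality
open import Relation.Binary.Definitions using (tri<; tri≈; tri>)
open import Function using (_∘_)
open ≡-Reasoning

≡ᵇ-true : ∀ {m n} → m ≡ n → (m ≡ᵇ n) ≡ true
≡ᵇ-true {m} {n} = dec-true (m ≟ n)

≡ᵇ-false : ∀ {m n} → m ≢ n → (m ≡ᵇ n) ≡ false
≡ᵇ-false {m} {n} = dec-false (m ≟ n)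

≡ᵇ-sound : ∀ {m n} → (m ≡ᵇ n) ≡ true → m ≡ n
≡ᵇ-sound {m} {n} e = ≡ᵇ⇒≡ m n (subst T (sym e) _)

≡ᵇ-reflects : ∀ m n → Reflects (m ≡ n) (m ≡ᵇ n)
≡ᵇ-reflects m n = proof (m ≟ n)

true≢false : true ≢ false
true≢false ()

new≢old : ∀ {a b} → new a ≢ old b
new≢old ()

new-injective : ∀ {a b} → new a ≡ new b → a ≡ b
new-injective refl = refl

old-injective : ∀ {a b} → old a ≡ old b → a ≡ b
old-injective refl = refl

-- A labelling obtained from p by a
-- relabelling that is injective on the labels used by p has the same blocks
-- as p; this is how f(i,q) and g(i,q) are compared with simpler models.

SameBlocks : {L L' : Set} → (ℕ → L) → (ℕ → L') → Set
SameBlocks p p' = ∀ x y → (p x ≡ p y → p' x ≡ p' y) × (p' x ≡ p' y → p x ≡ p y)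

sameBlocks-relabel : ∀ {L L' : Set} {p : ℕ → L} {p' : ℕ → L'} (φ : L → L') →
  (∀ x → p' x ≡ φ (p x)) → (∀ x y → φ (p x) ≡ φ (p y) → p x ≡ p y) →
  SameBlocks p p'
sameBlocks-relabel {p = p} {p'} φ p'≡φp φ-inj x y =
  (λ pxy → begin
     p' x     ≡⟨ p'≡φp x ⟩
     φ (p x)  ≡⟨ cong φ pxy ⟩
     φ (p y)  ≡⟨ p'≡φp y ⟨
     p' y     ∎)
  , (λ p'xy → φ-inj x y (trans (sym (p'≡φp x)) (trans p'xy (p'≡φp y))))

W-resp : ∀ {L L' : Set} {n r} {p : ℕ → L} {p' : ℕ → L'} →
  SameBlocks p p' → W n r p → W n r p'
W-resp same (nc , nonSingle , distinct) =
  (λ a b c d 1≤a a<b b<c c<d d≤n ac bd →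
     proj₁ (same a b) (nc a b c d 1≤a a<b b<c c<d d≤n (proj₂ (same a c) ac) (proj₂ (same b d) bd)))
  , (λ j 1≤j j≤ single → nonSingle j 1≤j j≤ (λ y 1≤y y≤n pyj → single y 1≤y y≤n (proj₁ (same y j) pyj)))
  , (λ j k 1≤j j<k k≤ pjk → distinct j k 1≤j j<k k≤ (proj₂ (same j k) pjk))

partner⇒nonSingleton : ∀ {L : Set} {n} {p : ℕ → L} {j y} →
  1 ≤ y → y ≤ n → y ≢ j → p y ≡ p j → ¬ Singleton n p j
partner⇒nonSingleton 1≤y y≤n y≢j pyj single = y≢j (single _ 1≤y y≤n pyj)

partner : ∀ {n} (p : ℕ → ℕ) {j} → ¬ Singleton n p j →
  ∃ λ y → 1 ≤ y × y ≤ n × y ≢ j × p y ≡ p j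
partner {n} p {j} notSingle
  with anyUpTo? (λ y → (1 ≤? y) ×-dec (¬? (y ≟ j) ×-dec (p y ≟ p j))) (suc n)
... | yes (y , y<1+n , 1≤y , y≢j , pyj) = y , 1≤y , ≤-pred y<1+n , y≢j , pyj
... | no none = ⊥-elim (notSingle onlyJ)
  where
  onlyJ : Singleton n p j
  onlyJ y 1≤y y≤n pyj with y ≟ j
  ... | yes y≡j = y≡j
  ... | no y≢j = ⊥-elim (none (y , s≤s y≤n , 1≤y , y≢j , pyj))

-- Non-crossing is preserved by pulling back along a monotone self-map τ of
-- {1,…,n}: a crossing of p ∘ τ either collapses (two consecutive points have
-- the same image, which already forces the conclusion) or is mapped to a
-- crossing of p.
nonCrossing-reindex : ∀ {L : Set} {n} {p : ℕ → L} (τ : ℕ → ℕ) → NonCrossing n p →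
  (∀ {x y} → x ≤ y → τ x ≤ τ y) → (∀ {x} → 1 ≤ x → 1 ≤ τ x) → (∀ {x} → x ≤ n → τ x ≤ n) →
  NonCrossing n (λ x → p (τ x))
nonCrossing-reindex {p = p} τ nc mono pos bounded a b c d 1≤a a<b b<c c<d d≤n ac bd
  with m≤n⇒m<n∨m≡n (mono (<⇒≤ a<b)) | m≤n⇒m<n∨m≡n (mono (<⇒≤ b<c))
     | m≤n⇒m<n∨m≡n (mono (<⇒≤ c<d))
... | inj₂ τa≡τb | _ | _ = cong p τa≡τb
... | inj₁ _ | inj₂ τb≡τc | _ = trans ac (cong p (sym τb≡τc))
... | inj₁ _ | inj₁ _ | inj₂ τc≡τd = trans ac (trans (cong p τc≡τd) (sym bd))
... | inj₁ τa<τb | inj₁ τb<τc | inj₁ τc<τd =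
  nc (τ a) (τ b) (τ c) (τ d) (pos 1≤a) τa<τb τb<τc τc<τd (bounded d≤n) ac bd

isolate : {L : Set} → (ℕ → Bool) → (ℕ → L) → ℕ → Maybe L
isolate P p x = if P x then nothing else just (p x)

AtMostOne : (ℕ → Bool) → Set
AtMostOne P = ∀ {x y} → P x ≡ true → P y ≡ true → x ≡ y

module _ {L : Set} {P : ℕ → Bool} {p : ℕ → L} where

  isolate-free : ∀ {x} → P x ≡ false → isolate P p x ≡ just (p x)
  isolate-free {x} Px = cong (λ b → if b then nothing else just (p x)) Px

  isolate-at : ∀ {x} → P x ≡ true → isolate P p x ≡ nothing
  isolate-at {x} Px = cong (λ b → if b then nothing else just (p x)) Px

  isolate-sameBlock : AtMostOne P → ∀ {x y} → x ≢ y → isolate P p x ≡ isolate P p y →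
    P x ≡ false × P y ≡ false × p x ≡ p y
  isolate-sameBlock one {x} {y} x≢y e with P x in Px | P y in Py
  ... | true | true = ⊥-elim (x≢y (one Px Py))
  ... | false | false = refl , refl , just-injective e
  isolate-sameBlock one x≢y () | true | false
  isolate-sameBlock one x≢y () | false | true

  nonCrossing-isolate : ∀ {n} → AtMostOne P → NonCrossing n p → NonCrossing n (isolate P p)
  nonCrossing-isolate one nc a b c d 1≤a a<b b<c c<d d≤n ac bd
    with isolate-sameBlock one (<⇒≢ (<-trans a<b b<c)) ac
       | isolate-sameBlock one (<⇒≢ (<-trans b<c c<d)) bd
  ... | Pa , _ , pac | Pb , _ , pbd = begin
    isolate P p a  ≡⟨ isolate-free Pa ⟩
    just (p a)     ≡⟨ cong just (nc a b c d 1≤a a<b b<c c<d d≤n pac pbd) ⟩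
    just (p b)     ≡⟨ isolate-free Pb ⟨
    isolate P p b  ∎

Inside : ℕ → ℕ → ℕ → Set
Inside x y u = x < u × u < y

block-side : ∀ {L : Set} {n} {p : ℕ → L} {x y u w} → NonCrossing n p →
  1 ≤ x → x < y → y ≤ n → p x ≡ p y → 1 ≤ w → w ≤ n →
  p u ≡ p w → p u ≢ p x → Inside x y u → Inside x y w
block-side {x = x} {y} {u} {w} nc 1≤x x<y y≤n pxy 1≤w w≤n puw pu≢px (x<u , u<y) with <-cmp w x
... | tri< w<x _ _ = ⊥-elim (pu≢px (trans puw (nc w x u y 1≤w w<x x<u u<y y≤n (sym puw) pxy)))
... | tri≈ _ refl _ = ⊥-elim (pu≢px puw)
... | tri> _ _ x<w with <-cmp w y
...   | tri< w<y _ _ = x<w , w<y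
...   | tri≈ _ refl _ = ⊥-elim (pu≢px (trans puw (sym pxy)))
...   | tri> _ _ y<w = ⊥-elim (pu≢px (sym (nc x u y w 1≤x x<u u<y y<w w≤n pxy puw)))

inside-near : ∀ {x y c c'} → Inside x y c → c' ≤ suc c → c ≤ suc c' → c' ≢ x → c' ≢ y → Inside x y c'
inside-near (x<c , c<y) c'≤1+c c≤1+c' c'≢x c'≢y =
  ≤∧≢⇒< (≤-pred (≤-trans x<c c≤1+c')) (c'≢x ∘ sym) , ≤∧≢⇒< (≤-trans c'≤1+c c<y) c'≢y

merge : (ℕ → ℕ) → ℕ → ℕ → ℕ → ℕ
merge q a b x = if q x ≡ᵇ q a then q b else q x

module MergeBlocks (q : ℕ → ℕ) (a b : ℕ) where

  Merged : ℕ → Set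
  Merged x = q x ≡ q a ⊎ q x ≡ q b

  merged? : ∀ x → Dec (Merged x)
  merged? x = (q x ≟ q a) ⊎-dec (q x ≟ q b)

  merged-resp : ∀ {x y} → q x ≡ q y → Merged x → Merged y
  merged-resp qxy (inj₁ e) = inj₁ (trans (sym qxy) e)
  merged-resp qxy (inj₂ e) = inj₂ (trans (sym qxy) e)

  merge-merged : ∀ {x} → Merged x → merge q a b x ≡ q b
  merge-merged {x} mx with q x ≡ᵇ q a | ≡ᵇ-reflects (q x) (q a) | mx
  ... | true | _ | _ = refl
  ... | false | ofⁿ x≉a | inj₁ e = ⊥-elim (x≉a e)
  ... | false | _ | inj₂ e = e

  merge-unmerged : ∀ {x} → ¬ Merged x → merge q a b x ≡ q x
  merge-unmerged {x} ux = cong (λ c → if c then q b else q x) (≡ᵇ-false (λ e → ux (inj₁ e)))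

  merge-cong : ∀ {x y} → q x ≡ q y → merge q a b x ≡ merge q a b y
  merge-cong {x} {y} qxy = cong (λ v → if v ≡ᵇ q a then q b else v) qxy

  merge-join : ∀ {x y} → Merged x → Merged y → merge q a b x ≡ merge q a b y
  merge-join mx my = trans (merge-merged mx) (sym (merge-merged my))

  merge-sameBlock : ∀ {x y} → merge q a b x ≡ merge q a b y → q x ≡ q y ⊎ (Merged x × Merged y)
  merge-sameBlock {x} {y} e with merged? x | merged? y
  ... | yes mx | yes my = inj₂ (mx , my)
  ... | yes mx | no uy = ⊥-elim (uy (inj₂ (trans (sym (merge-unmerged uy)) (trans (sym e) (merge-merged mx)))))
  ... | no ux | yes my = ⊥-elim (ux (inj₂ (trans (sym (merge-unmerged ux)) (trans e (merge-merged my)))))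
  ... | no ux | no uy = inj₁ (trans (sym (merge-unmerged ux)) (trans e (merge-unmerged uy)))

  sameBlock-merged : ∀ {x y} → merge q a b x ≡ merge q a b y → Merged x → Merged y
  sameBlock-merged e mx with merge-sameBlock e
  ... | inj₁ qxy = merged-resp qxy mx
  ... | inj₂ (_ , my) = my

  sameBlock-unmerged : ∀ {x y} → merge q a b x ≡ merge q a b y → ¬ Merged x → q x ≡ q y
  sameBlock-unmerged e ux with merge-sameBlock e
  ... | inj₁ qxy = qxy
  ... | inj₂ (mx , _) = ⊥-elim (ux mx)

  representative : ∀ {u} → Merged u → ∃ λ c → (c ≡ a ⊎ c ≡ b) × q u ≡ q c
  representative (inj₁ e) = a , inj₁ refl , e
  representative (inj₂ e) = b , inj₂ refl , e

  near : a ≤ suc b → b ≤ suc a → ∀ {d d'} → d ≡ a ⊎ d ≡ b → d' ≡ a ⊎ d' ≡ b → d' ≤ suc d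
  near _ _ (inj₁ refl) (inj₁ refl) = n≤1+n a
  near _ b≤1+a (inj₁ refl) (inj₂ refl) = b≤1+a
  near a≤1+b _ (inj₂ refl) (inj₁ refl) = a≤1+b
  near _ _ (inj₂ refl) (inj₂ refl) = n≤1+n b

  -- For a and b at distance at most one, the merged blocks cannot have points
  -- strictly on both sides of a pair x < y of another block: by block-side
  -- the representatives of these points would lie on the same two sides,
  -- but a and b are too close to be separated by x and y.
  merged-oneSide : ∀ {n} → NonCrossing n q → a ≤ suc b → b ≤ suc a →
    1 ≤ a → a ≤ n → 1 ≤ b → b ≤ n → ∀ {x y u v} →
    1 ≤ x → x < y → y ≤ n → q x ≡ q y → ¬ Merged x →
    Merged u → Inside x y u → Merged v → 1 ≤ v → v ≤ n → v < x ⊎ y < v → ⊥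
  merged-oneSide {n} nc a≤1+b b≤1+a 1≤a a≤n 1≤b b≤n {x} {y} {u} {v} 1≤x x<y y≤n qxy ux mu u-in mv 1≤v v≤n v-out
    with representative mu | representative mv
  ... | c , c∈ab , quc | c' , c'∈ab , qvc' = outside (block-side nc 1≤x x<y y≤n qxy 1≤v v≤n
         (sym qvc') (λ e → ux (merged-resp e (merged-resp qvc' mv))) c'-in)
    where
    range : ∀ {d} → d ≡ a ⊎ d ≡ b → 1 ≤ d × d ≤ n
    range (inj₁ refl) = 1≤a , a≤n
    range (inj₂ refl) = 1≤b , b≤n
    c-in : Inside x y c
    c-in = block-side nc 1≤x x<y y≤n qxy (proj₁ (range c∈ab)) (proj₂ (range c∈ab)) quc
             (λ e → ux (merged-resp e mu)) u-in
    -- c' ∉ {x, y} since it is merged while x and y are not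
    c'≢ : ∀ {z} → q z ≡ q x → c' ≢ z
    c'≢ qzx refl = ux (merged-resp qzx (merged-resp qvc' mv))
    c'-in : Inside x y c'
    c'-in = inside-near c-in (near a≤1+b b≤1+a c∈ab c'∈ab) (near a≤1+b b≤1+a c'∈ab c∈ab)
              (c'≢ refl) (c'≢ (sym qxy))
    outside : Inside x y v → ⊥
    outside (x<v , v<y) = [ <-asym x<v , <-asym v<y ]′ v-out

  nonCrossing-merge : ∀ {n} → NonCrossing n q → a ≤ suc b → b ≤ suc a →
    1 ≤ a → a ≤ n → 1 ≤ b → b ≤ n → NonCrossing n (merge q a b)
  nonCrossing-merge nc a≤ b≤ 1≤a a≤n 1≤b b≤n x y z w 1≤x x<y y<z z<w w≤n xz yw
    with merged? x | merged? y
  ... | yes mx | yes my = merge-join mx my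
  ... | no ux | no uy = merge-cong
        (nc x y z w 1≤x x<y y<z z<w w≤n (sameBlock-unmerged xz ux) (sameBlock-unmerged yw uy))
  ... | yes mx | no uy = ⊥-elim (merged-oneSide nc a≤ b≤ 1≤a a≤n 1≤b b≤n
        (≤-trans 1≤x (<⇒≤ x<y)) (<-trans y<z z<w) w≤n (sameBlock-unmerged yw uy) uy
        (sameBlock-merged xz mx) (y<z , z<w) mx 1≤x (≤-trans (<⇒≤ (<-trans x<y (<-trans y<z z<w))) w≤n) (inj₁ x<y))
  ... | no ux | yes my = ⊥-elim (merged-oneSide nc a≤ b≤ 1≤a a≤n 1≤b b≤n
        1≤x (<-trans x<y y<z) (≤-trans (<⇒≤ z<w) w≤n) (sameBlock-unmerged xz ux) ux
        my (x<y , y<z) (sameBlock-merged yw my) (≤-trans 1≤x (<⇒≤ (<-trans x<y (<-trans y<z z<w)))) w≤n (inj₂ z<w))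

shift : ℕ → ℕ → ℕ → ℕ
shift i t x with i ≤? x | x ≤? t
... | yes _ | yes _ = suc x
... | _ | _ = x

data ShiftView (i t x : ℕ) : ℕ → Set where
  below : x < i → ShiftView i t x x
  inside : i ≤ x → x ≤ t → ShiftView i t x (suc x)
  above : t < x → ShiftView i t x x

shiftView : ∀ i t x → ShiftView i t x (shift i t x)
shiftView i t x with i ≤? x | x ≤? t
... | yes i≤x | yes x≤t = inside i≤x x≤t
... | no i≰x | _ = below (≰⇒> i≰x)
... | yes _ | no x≰t = above (≰⇒> x≰t)

module _ {i t : ℕ} where

  shift-below : ∀ {x} → x < i → shift i t x ≡ x
  shift-below {x} x<i with shift i t x | shiftView i t x
  ... | _ | below _ = refl
  ... | _ | inside i≤x _ = ⊥-elim (<⇒≱ x<i i≤x)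
  ... | _ | above _ = refl

  shift-inside : ∀ {x} → i ≤ x → x ≤ t → shift i t x ≡ suc x
  shift-inside {x} i≤x x≤t with shift i t x | shiftView i t x
  ... | _ | below x<i = ⊥-elim (<⇒≱ x<i i≤x)
  ... | _ | inside _ _ = refl
  ... | _ | above t<x = ⊥-elim (<⇒≱ t<x x≤t)

  shift-above : ∀ {x} → t < x → shift i t x ≡ x
  shift-above {x} t<x with shift i t x | shiftView i t x
  ... | _ | below _ = refl
  ... | _ | inside _ x≤t = ⊥-elim (<⇒≱ t<x x≤t)
  ... | _ | above _ = refl

  shift-bounds : ∀ x → x ≤ shift i t x × shift i t x ≤ suc x
  shift-bounds x with shift i t x | shiftView i t x
  ... | _ | below _ = ≤-refl , n≤1+n x
  ... | _ | inside _ _ = n≤1+n x , ≤-refl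
  ... | _ | above _ = ≤-refl , n≤1+n x

  shift-mono : ∀ {x y} → x ≤ y → shift i t x ≤ shift i t y
  shift-mono {x} {y} x≤y with shift i t x | shiftView i t x | shift i t y | shiftView i t y
  ... | _ | inside _ _ | _ | inside _ _ = s≤s x≤y
  ... | _ | inside i≤x _ | _ | below y<i = ⊥-elim (<⇒≱ y<i (≤-trans i≤x x≤y))
  ... | _ | inside _ x≤t | _ | above t<y = ≤-<-trans x≤t t<y
  ... | _ | above t<x | _ | inside _ y≤t = ⊥-elim (<⇒≱ t<x (≤-trans x≤y y≤t))
  ... | _ | below _ | _ | inside _ _ = m≤n⇒m≤1+n x≤y
  ... | _ | below _ | _ | below _ = x≤y
  ... | _ | below _ | _ | above _ = x≤y
  ... | _ | above _ | _ | below _ = x≤y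
  ... | _ | above _ | _ | above _ = x≤y

  shift-strict : ∀ {x y} → x < y → y ≤ t → shift i t x < shift i t y
  shift-strict {x} {y} x<y y≤t with x <? i
  ... | yes x<i = subst (_< shift i t y) (sym (shift-below x<i)) (<-≤-trans x<y (proj₁ (shift-bounds y)))
  ... | no x≮i = subst₂ _<_ (sym (shift-inside i≤x (≤-trans (<⇒≤ x<y) y≤t)))
                             (sym (shift-inside (≤-trans i≤x (<⇒≤ x<y)) y≤t)) (s≤s x<y)
    where i≤x = ≮⇒≥ x≮i

  shift-bounded : ∀ {n x} → t < n → x ≤ n → shift i t x ≤ n
  shift-bounded {n} {x} t<n x≤n with shift i t x | shiftView i t x
  ... | _ | below _ = x≤n
  ... | _ | inside _ x≤t = ≤-trans (s≤s x≤t) t<n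
  ... | _ | above _ = x≤n

  shift-avoids : ∀ {x} → x ≤ t → shift i t x ≢ i
  shift-avoids {x} x≤t with shift i t x | shiftView i t x
  ... | _ | below x<i = <⇒≢ x<i
  ... | _ | inside i≤x _ = λ e → <⇒≱ (s≤s i≤x) (≤-reflexive e)
  ... | _ | above t<x = ⊥-elim (<⇒≱ t<x x≤t)

-- Parity.  Writing ⌈r/2⌉ as r / 2 + r % 2 (the non-singleton bound of
-- W(n,r)), the bounds of W(n,r+1) are ⌈(r+1)/2⌉ = ⌊r/2⌋ + 1 and
-- ⌊(r+1)/2⌋ = ⌈r/2⌉.

/2-step : ∀ m → suc (suc m) / 2 ≡ suc (m / 2)
/2-step m = m/n≡1+[m∸n]/n {suc (suc m)} {2} (s≤s (s≤s z≤n))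

%2-step : ∀ m → suc (suc m) % 2 ≡ m % 2
%2-step m = trans (cong (_% 2) (+-comm 2 m)) ([m+n]%n≡m%n m 2)

half-suc : ∀ r → suc r / 2 ≡ r / 2 + r % 2
half-suc zero = refl
half-suc (suc zero) = refl
half-suc (suc (suc r)) = begin
  suc (suc (suc r)) / 2              ≡⟨ /2-step (suc r) ⟩
  suc (suc r / 2)                    ≡⟨ cong suc (half-suc r) ⟩
  suc (r / 2) + r % 2                ≡⟨ cong₂ _+_ (/2-step r) (%2-step r) ⟨
  suc (suc r) / 2 + suc (suc r) % 2  ∎

ceil-suc : ∀ r → suc r / 2 + suc r % 2 ≡ suc (r / 2)
ceil-suc zero = refl
ceil-suc (suc zero) = refl
ceil-suc (suc (suc r)) = begin
  suc (suc (suc r)) / 2 + suc (suc (suc r)) % 2  ≡⟨ cong₂ _+_ (/2-step (suc r)) (%2-step (suc r)) ⟩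
  suc (suc r / 2 + suc r % 2)                    ≡⟨ cong suc (ceil-suc r) ⟩
  suc (suc (r / 2))                              ≡⟨ cong suc (/2-step r) ⟨
  suc (suc (suc r) / 2)                          ∎

parity : ∀ r → (isOdd r ≡ false × r / 2 + r % 2 ≡ r / 2) ⊎ (isOdd r ≡ true × r / 2 + r % 2 ≡ suc (r / 2))
parity r with r % 2 | m%n<n r 2
... | 0 | _ = inj₁ (refl , +-identityʳ (r / 2))
... | 1 | _ = inj₂ (refl , +-comm (r / 2) 1)
... | suc (suc _) | s≤s (s≤s ())

indexOf : (ℕ → ℕ) → ℕ → ℕ → ℕ → Maybe ℕ
indexOf q v lo zero = if v ≡ᵇ q lo then just lo else nothing
indexOf q v lo (suc k) = if v ≡ᵇ q lo then just lo else indexOf q v (suc lo) k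

findBlock-indexOf : ∀ q x lo k → findBlock q x lo k ≡ indexOf q (q x) lo k
findBlock-indexOf q x lo zero = refl
findBlock-indexOf q x lo (suc k) =
  cong (λ m → if q x ≡ᵇ q lo then just lo else m) (findBlock-indexOf q x (suc lo) k)

data IndexView (q : ℕ → ℕ) (v lo k : ℕ) : Maybe ℕ → Set where
  found : ∀ j → lo ≤ j → j ≤ lo + k → q j ≡ v → IndexView q v lo k (just j)
  absent : (∀ j → lo ≤ j → j ≤ lo + k → q j ≢ v) → IndexView q v lo k nothing

indexView : ∀ q v lo k → IndexView q v lo k (indexOf q v lo k)
indexView q v lo zero with v ≡ᵇ q lo | ≡ᵇ-reflects v (q lo)
... | true | ofʸ v≡ = found lo ≤-refl (m≤m+n lo 0) (sym v≡)
... | false | ofⁿ v≢ = absent λ j lo≤j j≤ qj≡v →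
  v≢ (trans (sym qj≡v) (cong q (≤-antisym (≤-trans j≤ (≤-reflexive (+-identityʳ lo))) lo≤j)))
indexView q v lo (suc k) with v ≡ᵇ q lo | ≡ᵇ-reflects v (q lo)
... | true | ofʸ v≡ = found lo ≤-refl (m≤m+n lo (suc k)) (sym v≡)
... | false | ofⁿ v≢ with indexOf q v (suc lo) k | indexView q v (suc lo) k
...   | just j | found .j lo<j j≤ qj≡v = found j (<⇒≤ lo<j) (≤-trans j≤ (≤-reflexive (sym (+-suc lo k)))) qj≡v
...   | nothing | absent none = absent notFound
  where
  notFound : ∀ j → lo ≤ j → j ≤ lo + suc k → q j ≢ v
  notFound j lo≤j j≤ qj≡v with m≤n⇒m<n∨m≡n lo≤j
  ... | inj₁ lo<j = none j lo<j (≤-trans j≤ (≤-reflexive (+-suc lo k))) qj≡v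
  ... | inj₂ refl = v≢ (sym qj≡v)

-- With s = ⌊r/2⌋ and
-- t = ⌈r/2⌉ (t = s for even r, t = s + 1 for odd r), the points 1..s+1 are
-- not singletons of q and the points 1..t+1 lie in pairwise different blocks.
module Setting (n r : ℕ) (q : ℕ → ℕ) (r+1<n : suc r < n) (q∈W : W n (suc r) q) where

  s t : ℕ
  s = r / 2
  t = r / 2 + r % 2

  nc : NonCrossing n q
  nc = proj₁ q∈W

  nonSingleton : ∀ j → 1 ≤ j → j ≤ suc s → ¬ Singleton n q j
  nonSingleton j 1≤j j≤ = proj₁ (proj₂ q∈W) j 1≤j (subst (j ≤_) (sym (ceil-suc r)) j≤)

  distinct : ∀ j k → 1 ≤ j → j < k → k ≤ suc t → q j ≢ q k
  distinct j k 1≤j j<k k≤ = proj₂ (proj₂ q∈W) j k 1≤j j<k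
    (subst (k ≤_) (sym (trans (cong (_+ 1) (half-suc r)) (+-comm t 1))) k≤)

  s≤t : s ≤ t
  s≤t = m≤m+n s (r % 2)

  t≤s+1 : t ≤ suc s
  t≤s+1 = ≤-trans (+-monoʳ-≤ s (≤-pred (m%n<n r 2))) (≤-reflexive (+-comm s 1))

  s+2≤n : suc (suc s) ≤ n
  s+2≤n = ≤-trans (s≤s (s≤s (m/n≤m r 2))) r+1<n

  t<n : t < n
  t<n = ≤-trans (s≤s t≤s+1) s+2≤n

  s+1≡ : r / 2 + 1 ≡ suc s
  s+1≡ = +-comm s 1

  s+2≡ : r / 2 + 2 ≡ suc (suc s)
  s+2≡ = +-comm s 2

  distinct-inj : ∀ {x y} → 1 ≤ x → 1 ≤ y → x ≤ suc t → y ≤ suc t → q x ≡ q y → x ≡ y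
  distinct-inj {x} {y} 1≤x 1≤y x≤ y≤ qxy with <-cmp x y
  ... | tri< x<y _ _ = ⊥-elim (distinct x y 1≤x x<y y≤ qxy)
  ... | tri≈ _ x≡y _ = x≡y
  ... | tri> _ _ y<x = ⊥-elim (distinct y x 1≤y y<x x≤ (sym qxy))

  PartnersBeyond : (ℕ → ℕ) → Set
  PartnersBeyond p = ∀ j → 1 ≤ j → j ≤ suc s → ∃ λ y → suc t < y × y ≤ n × p y ≡ p j

  -- By injectivity on 1..t+1, a partner of a point of 1..s+1 lies beyond t+1.
  partnerBeyond : PartnersBeyond q
  partnerBeyond j 1≤j j≤ with partner q (nonSingleton j 1≤j j≤)
  ... | y , 1≤y , y≤n , y≢j , qyj =
    y , ≰⇒> (λ y≤ → y≢j (distinct-inj 1≤y 1≤j y≤ (≤-trans j≤ (s≤s s≤t)) qyj)) , y≤n , qyj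

  odd⇒t≡s+1 : isOdd r ≡ true → t ≡ suc s
  odd⇒t≡s+1 odd with parity r
  ... | inj₁ (even , _) = ⊥-elim (true≢false (trans (sym odd) even))
  ... | inj₂ (_ , t≡s+1) = t≡s+1

  s<t⇒odd : s < t → isOdd r ≡ true
  s<t⇒odd s<t with parity r
  ... | inj₁ (_ , t≡s) = ⊥-elim (<⇒≢ s<t (sym t≡s))
  ... | inj₂ (odd , _) = odd

  -- the point s+1, which f(i,q) and g(i,q) turn into a singleton for even r
  isolated : ℕ → Bool
  isolated x = not (isOdd r) ∧ (x ≡ᵇ suc s)

  isolated-point : ∀ {x} → isolated x ≡ true → isOdd r ≡ false × x ≡ suc s
  isolated-point {x} iso =
    not-true (∧-conicalˡ (not (isOdd r)) _ iso) , ≡ᵇ-sound (∧-conicalʳ (not (isOdd r)) _ iso)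
    where not-true : ∀ {b} → not b ≡ true → b ≡ false
          not-true {false} _ = refl

  isolated-atMostOne : AtMostOne isolated
  isolated-atMostOne isoX isoY = trans (proj₂ (isolated-point isoX)) (sym (proj₂ (isolated-point isoY)))

  isolated-top : ∀ {x} → isOdd r ≡ false → x ≡ suc s → isolated x ≡ true
  isolated-top even x≡ = cong₂ (λ b c → not b ∧ c) even (≡ᵇ-true x≡)

  free-odd : ∀ {x} → isOdd r ≡ true → isolated x ≡ false
  free-odd {x} odd = cong (λ b → not b ∧ (x ≡ᵇ suc s)) odd

  free-≢ : ∀ {x} → x ≢ suc s → isolated x ≡ false
  free-≢ x≢ = trans (cong (not (isOdd r) ∧_) (≡ᵇ-false x≢)) (∧-zeroʳ (not (isOdd r)))

  free-≤t : ∀ {x} → x ≤ t → isolated x ≡ false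
  free-≤t {x} x≤t with parity r
  ... | inj₁ (_ , t≡s) = free-≢ {x} (λ x≡ → <⇒≱ (≤-reflexive (sym x≡)) (≤-trans x≤t (≤-reflexive t≡s)))
  ... | inj₂ (odd , _) = free-odd {x} odd

  beyond-t : ∀ {k} → t < k → k ≤ suc s → isOdd r ≡ false × k ≡ suc s
  beyond-t {k} t<k k≤ with parity r
  ... | inj₁ (even , t≡s) = even , ≤-antisym k≤ (subst (_< k) t≡s t<k)
  ... | inj₂ (_ , t≡s+1) = ⊥-elim (<⇒≱ t<k (subst (k ≤_) (sym t≡s+1) k≤))

  -- The window of f(i,q) and g(i,q) consists of the points i..s+1 whose
  -- blocks X(j) are rearranged.
  module Window (i : ℕ) (1≤i : 1 ≤ i) (i≤s+1 : i ≤ suc s) where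

    width : ℕ
    width = s + 1 ∸ i

    window-end : i + width ≡ suc s
    window-end = trans (m+[n∸m]≡n (subst (i ≤_) (sym (+-comm s 1)) i≤s+1)) (+-comm s 1)

    window≤t+1 : ∀ {j} → j ≤ suc s → j ≤ suc t
    window≤t+1 j≤ = ≤-trans j≤ (s≤s s≤t)

    data WindowView (v : ℕ) : Maybe ℕ → Set where
      inWindow : ∀ j → i ≤ j → j ≤ suc s → q j ≡ v → WindowView v (just j)
      outsideWindow : (∀ j → i ≤ j → j ≤ suc s → q j ≢ v) → WindowView v nothing

    windowView : ∀ v → WindowView v (indexOf q v i width)
    windowView v with indexOf q v i width | indexView q v i width
    ... | just j | found .j i≤j j≤ qj≡v = inWindow j i≤j (subst (j ≤_) window-end j≤) qj≡v
    ... | nothing | absent none = outsideWindow λ j i≤j j≤ → none j i≤j (subst (j ≤_) (sym window-end) j≤)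

    -- window points lie in different blocks, so each is found at its own index
    index-at : ∀ {j} → i ≤ j → j ≤ suc s → indexOf q (q j) i width ≡ just j
    index-at {j} i≤j j≤ with indexOf q (q j) i width | windowView (q j)
    ... | just j' | inWindow .j' i≤j' j'≤ qj'≡qj =
      cong just (distinct-inj (≤-trans 1≤i i≤j') (≤-trans 1≤i i≤j) (window≤t+1 j'≤) (window≤t+1 j≤) qj'≡qj)
    ... | nothing | outsideWindow none = ⊥-elim (none j i≤j j≤ refl)

    -- The points of K(j) = X(j) ∖ {j} get
    -- windowLabel c j: c for K(i) (new 0 in f, new i in g) and new (j-1) for
    -- j > i, as K(j) joins {j-1}.  Blocks outside the window keep their label,
    -- except X(s+2) for odd r, which joins {s+1}.
    windowLabel : Tag → ℕ → Tag
    windowLabel c j = if j ≡ᵇ i then c else new (j ∸ 1)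

    windowLabel-i : ∀ c → windowLabel c i ≡ c
    windowLabel-i c = cong (λ b → if b then c else new (i ∸ 1)) (≡ᵇ-true {i} refl)

    windowLabel-≢ : ∀ c {j} → j ≢ i → windowLabel c j ≡ new (j ∸ 1)
    windowLabel-≢ c {j} j≢i = cong (λ b → if b then c else new (j ∸ 1)) (≡ᵇ-false j≢i)

    outerLabel : ℕ → Tag
    outerLabel v = if isOdd r ∧ (v ≡ᵇ q (r / 2 + 2)) then new (r / 2 + 1) else old v

    -- the label of the points x ≠ j of a block X(j) of q, in terms of v = q x
    blockLabel : Tag → ℕ → Tag
    blockLabel c v = maybe′ (windowLabel c) (outerLabel v) (indexOf q v i width)

    pointLabel : Tag → ℕ → Maybe ℕ → Tag
    pointLabel c x (just j) = if x ≡ᵇ j then new j else windowLabel c j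
    pointLabel c x nothing = outerLabel (q x)

    -- f(i,q) and g(i,q) (for i ≤ s) differ only in the label of K(i)
    label : Tag → ℕ → Tag
    label c x = pointLabel c x (blockIn q s i x)

    f-label : ∀ x → f r i q x ≡ label (new 0) x
    f-label x with blockIn q s i x
    ... | just j = refl
    ... | nothing = refl

    gLow-label : ∀ x → gLow r i q x ≡ label (new i) x
    gLow-label x with blockIn q s i x
    ... | just j = refl
    ... | nothing = refl

    -- a window point x becomes part of the block {x} ∪ K(x+1), labelled new x
    label-center : ∀ c {x} → i ≤ x → x ≤ suc s → label c x ≡ new x
    label-center c {x} i≤x x≤ = begin
      label c x                ≡⟨ cong (pointLabel c x) (trans (findBlock-indexOf q x i width) (index-at i≤x x≤)) ⟩
      pointLabel c x (just x)  ≡⟨ cong (λ b → if b then new x else windowLabel c x) (≡ᵇ-true {x} refl) ⟩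
      new x                    ∎

    label-offCenter : ∀ c {x} → x < i ⊎ suc s < x → label c x ≡ blockLabel c (q x)
    label-offCenter c {x} off =
      trans (cong (pointLabel c x) (findBlock-indexOf q x i width)) (offCenter _ (windowView (q x)))
      where
      offCenter : ∀ m → WindowView (q x) m → pointLabel c x m ≡ maybe′ (windowLabel c) (outerLabel (q x)) m
      offCenter (just j) (inWindow .j i≤j j≤ _) = cong (λ b → if b then new j else windowLabel c j) (≡ᵇ-false x≢j)
        where
        x≢j : x ≢ j
        x≢j refl = [ (λ x<i → <⇒≱ x<i i≤j) , (λ s<x → <⇒≱ s<x j≤) ]′ off
      offCenter nothing _ = refl

    blockLabel-window : ∀ c {j} → i < j → j ≤ suc s → blockLabel c (q j) ≡ new (j ∸ 1)
    blockLabel-window c {j} i<j j≤ =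
      trans (cong (maybe′ (windowLabel c) (outerLabel (q j))) (index-at (<⇒≤ i<j) j≤)) (windowLabel-≢ c (>⇒≢ i<j))

    blockLabel-top : ∀ c → isOdd r ≡ true → blockLabel c (q (suc (suc s))) ≡ new (suc s)
    blockLabel-top c odd = begin
      blockLabel c (q (suc (suc s)))  ≡⟨ cong (maybe′ (windowLabel c) (outerLabel (q (suc (suc s))))) index-none ⟩
      outerLabel (q (suc (suc s)))    ≡⟨ cong₂ (λ o e → if o ∧ e then new (r / 2 + 1) else old (q (suc (suc s))))
                                               odd (≡ᵇ-true (cong q (sym s+2≡))) ⟩
      new (r / 2 + 1)                 ≡⟨ cong new s+1≡ ⟩
      new (suc s)                     ∎
      where
      index-none : indexOf q (q (suc (suc s))) i width ≡ nothing
      index-none with indexOf q (q (suc (suc s))) i width | windowView (q (suc (suc s)))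
      ... | just j | inWindow .j i≤j j≤ qj≡ = ⊥-elim (<⇒≢ (s≤s j≤)
            (distinct-inj (≤-trans 1≤i i≤j) (s≤s z≤n) (window≤t+1 j≤)
              (≤-reflexive (cong suc (sym (odd⇒t≡s+1 odd)))) qj≡))
      ... | nothing | _ = refl

    -- blockLabel (new 0) has a left inverse, hence is injective: new 0 labels
    -- K(i) ⊆ X(i), new m (m ≥ 1) labels K(m+1) or, for m = s+1, X(s+2)
    decode : Tag → ℕ
    decode (old v) = v
    decode (new zero) = q i
    decode (new (suc m)) = q (suc (suc m))

    decode-pred : ∀ {j} → 2 ≤ j → decode (new (j ∸ 1)) ≡ q j
    decode-pred {suc (suc _)} _ = refl
    decode-pred {suc zero} (s≤s ())

    decode-outerLabel : ∀ v → decode (outerLabel v) ≡ v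
    decode-outerLabel v with isOdd r ∧ (v ≡ᵇ q (r / 2 + 2)) in e
    ... | true = begin
      decode (new (r / 2 + 1))  ≡⟨ cong (decode ∘ new) s+1≡ ⟩
      q (suc (suc s))           ≡⟨ cong q s+2≡ ⟨
      q (r / 2 + 2)             ≡⟨ ≡ᵇ-sound (∧-conicalʳ (isOdd r) _ e) ⟨
      v                         ∎
    ... | false = refl

    decode-blockLabel : ∀ v → decode (blockLabel (new 0) v) ≡ v
    decode-blockLabel v = go _ (windowView v)
      where
      go : ∀ m → WindowView v m → decode (maybe′ (windowLabel (new 0)) (outerLabel v) m) ≡ v
      go (just j) (inWindow .j i≤j _ qj≡v) with j ≟ i
      ... | yes refl = trans (cong decode (windowLabel-i (new 0))) qj≡v
      ... | no j≢i = trans (cong decode (windowLabel-≢ (new 0) j≢i))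
                           (trans (decode-pred (≤-trans (s≤s 1≤i) (≤∧≢⇒< i≤j (λ e → j≢i (sym e))))) qj≡v)
      go nothing _ = decode-outerLabel v

    blockLabel-inj : ∀ {v v'} → blockLabel (new 0) v ≡ blockLabel (new 0) v' → v ≡ v'
    blockLabel-inj {v} {v'} e = begin
      v                               ≡⟨ decode-blockLabel v ⟨
      decode (blockLabel (new 0) v)   ≡⟨ cong decode e ⟩
      decode (blockLabel (new 0) v')  ≡⟨ decode-blockLabel v' ⟩
      v'                              ∎

    blockLabel-even : isOdd r ≡ false → ∀ v → blockLabel (new 0) v ≢ new (suc s)
    blockLabel-even even v = go _ (windowView v)
      where
      go : ∀ m → WindowView v m → maybe′ (windowLabel (new 0)) (outerLabel v) m ≢ new (suc s)
      go (just j) (inWindow .j _ j≤ _) e with j ≟ i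
      ... | yes refl = 0≢1+n (new-injective (trans (sym (windowLabel-i (new 0))) e))
      ... | no j≢i =
        1+n≰n (subst (_≤ s) (new-injective (trans (sym (windowLabel-≢ (new 0) j≢i)) e)) (∸-monoˡ-≤ 1 j≤))
      go nothing _ e = new≢old (trans (sym e)
        (cong (λ o → if o ∧ (v ≡ᵇ q (r / 2 + 2)) then new (r / 2 + 1) else old v) even))

    -- g(i,q) relabels K(i) into the block of i+1: its block labels are those
    -- of f(i,q) after merging the q-blocks of i and i+1
    blockLabel-merge : i ≤ s → ∀ v → blockLabel (new i) v ≡ blockLabel (new 0) (if v ≡ᵇ q i then q (suc i) else v)
    blockLabel-merge i≤s v with v ≡ᵇ q i | ≡ᵇ-reflects v (q i)
    ... | true | ofʸ refl = begin
      blockLabel (new i) (q i)        ≡⟨ cong (maybe′ (windowLabel (new i)) (outerLabel (q i)))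
                                              (index-at ≤-refl i≤s+1) ⟩
      windowLabel (new i) i           ≡⟨ windowLabel-i (new i) ⟩
      new i                           ≡⟨ blockLabel-window (new 0) (n<1+n i) (s≤s i≤s) ⟨
      blockLabel (new 0) (q (suc i))  ∎
    ... | false | ofⁿ v≢qi = go _ (windowView v)
      where
      go : ∀ m → WindowView v m →
        maybe′ (windowLabel (new i)) (outerLabel v) m ≡ maybe′ (windowLabel (new 0)) (outerLabel v) m
      go (just j) (inWindow .j _ _ qj≡v) = trans (windowLabel-≢ (new i) j≢i) (sym (windowLabel-≢ (new 0) j≢i))
        where
        j≢i : j ≢ i
        j≢i refl = v≢qi (sym qj≡v)
      go nothing _ = refl

    -- The model of f(i,q) and g(i,q): pull a partition p back along the
    -- shift τ of [i, t] and isolate s+1 when r is even.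
    τ : ℕ → ℕ
    τ = shift i t

    model : (ℕ → ℕ) → ℕ → Maybe ℕ
    model p = isolate isolated (λ x → p (τ x))

    modelLabel : Tag → Maybe ℕ → Tag
    modelLabel c nothing = new (suc s)
    modelLabel c (just v) = blockLabel c v

    model-free : ∀ p {x} → isolated x ≡ false → model p x ≡ just (p (τ x))
    model-free p = isolate-free {P = isolated} {p = λ x → p (τ x)}

    model-isolated : ∀ p {x} → isolated x ≡ true → model p x ≡ nothing
    model-isolated p = isolate-at {P = isolated} {p = λ x → p (τ x)}

    label-model : ∀ c x → label c x ≡ modelLabel c (model q x)
    label-model c x with x <? i | x ≤? s
    ... | yes x<i | _ = begin
      label c x                 ≡⟨ label-offCenter c (inj₁ x<i) ⟩
      blockLabel c (q x)        ≡⟨ cong (blockLabel c ∘ q) (shift-below x<i) ⟨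
      blockLabel c (q (τ x))    ≡⟨ cong (modelLabel c) (model-free q (free-≢ x≢s+1)) ⟨
      modelLabel c (model q x)  ∎
      where
      x≢s+1 : x ≢ suc s
      x≢s+1 refl = <⇒≱ x<i i≤s+1
    ... | no x≮i | yes x≤s = begin
      label c x                 ≡⟨ label-center c (≮⇒≥ x≮i) (m≤n⇒m≤1+n x≤s) ⟩
      new x                     ≡⟨ blockLabel-window c (s≤s (≮⇒≥ x≮i)) (s≤s x≤s) ⟨
      blockLabel c (q (suc x))  ≡⟨ cong (blockLabel c ∘ q) (shift-inside (≮⇒≥ x≮i) (≤-trans x≤s s≤t)) ⟨
      blockLabel c (q (τ x))    ≡⟨ cong (modelLabel c) (model-free q (free-≤t (≤-trans x≤s s≤t))) ⟨
      modelLabel c (model q x)  ∎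
    ... | no x≮i | no x≰s with m≤n⇒m<n∨m≡n (≰⇒> x≰s)
    ...   | inj₁ s+1<x = begin
      label c x                 ≡⟨ label-offCenter c (inj₂ s+1<x) ⟩
      blockLabel c (q x)        ≡⟨ cong (blockLabel c ∘ q) (shift-above (≤-<-trans t≤s+1 s+1<x)) ⟨
      blockLabel c (q (τ x))    ≡⟨ cong (modelLabel c) (model-free q (free-≢ (>⇒≢ s+1<x))) ⟨
      modelLabel c (model q x)  ∎
    ...   | inj₂ refl with parity r
    ...     | inj₁ (even , _) = begin
      label c (suc s)                 ≡⟨ label-center c i≤s+1 ≤-refl ⟩
      new (suc s)                     ≡⟨ cong (modelLabel c) (model-isolated q (isolated-top {suc s} even refl)) ⟨
      modelLabel c (model q (suc s))  ∎
    ...     | inj₂ (odd , t≡s+1) = begin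
      label c (suc s)                 ≡⟨ label-center c i≤s+1 ≤-refl ⟩
      new (suc s)                     ≡⟨ blockLabel-top c odd ⟨
      blockLabel c (q (suc (suc s)))  ≡⟨ cong (blockLabel c ∘ q) (shift-inside i≤s+1 (≤-reflexive (sym t≡s+1))) ⟨
      blockLabel c (q (τ (suc s)))    ≡⟨ cong (modelLabel c) (model-free q (free-odd {suc s} odd)) ⟨
      modelLabel c (model q (suc s))  ∎

    modelLabel-merge : i ≤ s → ∀ x →
      modelLabel (new i) (model q x) ≡ modelLabel (new 0) (model (merge q i (suc i)) x)
    modelLabel-merge i≤s x with isolated x
    ... | true = refl
    ... | false = blockLabel-merge i≤s (q (τ x))

    modelLabel-inj : ∀ p x y → modelLabel (new 0) (model p x) ≡ modelLabel (new 0) (model p y) →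
      model p x ≡ model p y
    modelLabel-inj p x y e with isolated x in isoX | isolated y in isoY
    ... | true | true = refl
    ... | false | false = cong just (blockLabel-inj e)
    ... | true | false = ⊥-elim (blockLabel-even (proj₁ (isolated-point {x} isoX)) _ (sym e))
    ... | false | true = ⊥-elim (blockLabel-even (proj₁ (isolated-point {y} isoY)) _ e)

    f-model : SameBlocks (model q) (f r i q)
    f-model = sameBlocks-relabel (modelLabel (new 0))
      (λ x → trans (f-label x) (label-model (new 0) x)) (modelLabel-inj q)

    gLow-model : i ≤ s → SameBlocks (model (merge q i (suc i))) (gLow r i q)
    gLow-model i≤s = sameBlocks-relabel (modelLabel (new 0))
      (λ x → trans (gLow-label x) (trans (label-model (new i) x) (modelLabel-merge i≤s x)))
      (modelLabel-inj (merge q i (suc i)))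

    model-nonCrossing : ∀ p → NonCrossing n p → NonCrossing n (model p)
    model-nonCrossing p ncp = nonCrossing-isolate isolated-atMostOne
      (nonCrossing-reindex τ ncp shift-mono (λ 1≤x → ≤-trans 1≤x (proj₁ (shift-bounds _))) (shift-bounded t<n))

    model-sameBlock : ∀ p {x y} → isolated x ≡ false → isolated y ≡ false →
      p (τ x) ≡ p (τ y) → model p x ≡ model p y
    model-sameBlock p {x} {y} free-x free-y pτ = begin
      model p x       ≡⟨ model-free p free-x ⟩
      just (p (τ x))  ≡⟨ cong just pτ ⟩
      just (p (τ y))  ≡⟨ model-free p free-y ⟨
      model p y       ∎

    -- The points 1..t are not singletons of the model.  A partner of τ j
    -- beyond t+1 is fixed by τ; and only for odd r can τ j exceed s+1, when
    -- τ j = t + 1 = τ (t + 1).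
    model-nonSingleton : ∀ p → PartnersBeyond p → ∀ j → 1 ≤ j → j ≤ t → ¬ Singleton n (model p) j
    model-nonSingleton p partners j 1≤j j≤t with τ j ≤? suc s
    ... | yes τj≤ with partners (τ j) (≤-trans 1≤j (proj₁ (shift-bounds j))) τj≤
    ...   | y , t+1<y , y≤n , py≡ = partner⇒nonSingleton (≤-trans (s≤s z≤n) t+1<y) y≤n
            (λ y≡j → <⇒≱ t+1<y (≤-trans (≤-reflexive y≡j) (m≤n⇒m≤1+n j≤t)))
            (model-sameBlock p (free-≢ (>⇒≢ (≤-<-trans (s≤s s≤t) t+1<y))) (free-≤t j≤t)
               (trans (cong p (shift-above (<-trans (n<1+n t) t+1<y))) py≡))
    model-nonSingleton p partners j 1≤j j≤t | no τj≰ = partner⇒nonSingleton (s≤s z≤n) t<n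
            (λ t+1≡j → 1+n≰n (≤-trans (≤-reflexive t+1≡j) j≤t))
            (model-sameBlock p (free-odd {suc t} (s<t⇒odd s<t)) (free-≤t j≤t)
               (cong p (trans (shift-above (n<1+n t)) (sym τj≡t+1))))
      where
      τj≤t+1 : τ j ≤ suc t
      τj≤t+1 = ≤-trans (proj₂ (shift-bounds j)) (s≤s j≤t)
      s<t : s < t
      s<t = ≤-pred (<-≤-trans (≰⇒> τj≰) τj≤t+1)
      τj≡t+1 : τ j ≡ suc t
      τj≡t+1 = ≤-antisym τj≤t+1 (≤-trans (s≤s t≤s+1) (≰⇒> τj≰))

    Separated : (ℕ → ℕ) → Set
    Separated p = ∀ j k → 1 ≤ j → j < k → k ≤ t → p (τ j) ≢ p (τ k)

    -- The points 1..s+1 lie in different blocks of the model: those up to t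
    -- because p separates their images, and a remaining point (s+1 for even r)
    -- because it is isolated.
    model-separated : ∀ p → Separated p → ∀ j k → 1 ≤ j → j < k → k ≤ r / 2 + 1 → model p j ≢ model p k
    model-separated p separated j k 1≤j j<k k≤ e with isolate-sameBlock isolated-atMostOne (<⇒≢ j<k) e
    ... | _ , free-k , pτ with ≤-<-connex k t
    ...   | inj₁ k≤t = separated j k 1≤j j<k k≤t pτ
    ...   | inj₂ t<k = true≢false (trans (sym (isolated-top {k} even k≡s+1)) free-k)
      where
      beyond = beyond-t t<k (subst (k ≤_) s+1≡ k≤)
      even = proj₁ beyond
      k≡s+1 = proj₂ beyond

    q-separated : Separated q
    q-separated j k 1≤j j<k k≤t = distinct (τ j) (τ k) (≤-trans 1≤j (proj₁ (shift-bounds j)))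
      (shift-strict j<k k≤t) (≤-trans (proj₂ (shift-bounds k)) (s≤s k≤t))

    f-W : W n r (f r i q)
    f-W = W-resp {r = r} f-model
      (model-nonCrossing q nc , model-nonSingleton q partnerBeyond , model-separated q q-separated)

    gLow-W : i ≤ s → W n r (gLow r i q)
    gLow-W i≤s = W-resp {r = r} (gLow-model i≤s)
      (model-nonCrossing q' nonCrossing , model-nonSingleton q' partners , model-separated q' separated)
      where
      open MergeBlocks q i (suc i)
      q' : ℕ → ℕ
      q' = merge q i (suc i)

      i+1≤n : suc i ≤ n
      i+1≤n = ≤-trans (s≤s i≤s) (≤-trans (n≤1+n (suc s)) s+2≤n)

      nonCrossing : NonCrossing n q'
      nonCrossing = nonCrossing-merge nc (≤-trans (n≤1+n i) (n≤1+n (suc i))) ≤-refl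
        1≤i (≤-trans (n≤1+n i) i+1≤n) (s≤s z≤n) i+1≤n

      partners : PartnersBeyond q'
      partners j 1≤j j≤ with partnerBeyond j 1≤j j≤
      ... | y , t+1<y , y≤n , qyj = y , t+1<y , y≤n , merge-cong qyj

      -- τ(1..t) avoids i, so the only merged point among its values is i+1
      merged-image : ∀ {x} → 1 ≤ x → x ≤ t → Merged (τ x) → τ x ≡ suc i
      merged-image {x} 1≤x x≤t (inj₁ qτx≡qi) = ⊥-elim (shift-avoids x≤t
        (distinct-inj (≤-trans 1≤x (proj₁ (shift-bounds x))) 1≤i (≤-trans (proj₂ (shift-bounds x)) (s≤s x≤t))
          (window≤t+1 i≤s+1) qτx≡qi))
      merged-image {x} 1≤x x≤t (inj₂ qτx≡qi+1) =
        distinct-inj (≤-trans 1≤x (proj₁ (shift-bounds x))) (s≤s z≤n) (≤-trans (proj₂ (shift-bounds x)) (s≤s x≤t))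
          (window≤t+1 (s≤s i≤s)) qτx≡qi+1

      separated : Separated q'
      separated j k 1≤j j<k k≤t e with merge-sameBlock e
      ... | inj₁ qτjk = q-separated j k 1≤j j<k k≤t qτjk
      ... | inj₂ (mj , mk) = <⇒≢ (shift-strict j<k k≤t)
              (trans (merged-image 1≤j (≤-trans (<⇒≤ j<k) k≤t) mj)
                     (sym (merged-image (≤-trans 1≤j (<⇒≤ j<k)) k≤t mk)))

  gTop-merge : ∀ x → gTop r q x ≡ old (merge q (suc (suc s)) (suc s) x)
  gTop-merge x = trans (unfold x) (cong₂ (λ a b → old (merge q a b x)) s+2≡ s+1≡)
    where
    unfold : ∀ x → gTop r q x ≡ old (merge q (r / 2 + 2) (r / 2 + 1) x)
    unfold x with q x ≡ᵇ q (r / 2 + 2)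
    ... | true = refl
    ... | false = refl

  gTop-W : isOdd r ≡ true → W n r (gTop r q)
  gTop-W odd = W-resp {r = r} (sameBlocks-relabel old gTop-merge (λ _ _ → old-injective))
    (nonCrossing , nonSingle , separated)
    where
    open MergeBlocks q (suc (suc s)) (suc s)
    s+2≤t+1 : suc (suc s) ≤ suc t
    s+2≤t+1 = ≤-reflexive (cong suc (sym (odd⇒t≡s+1 odd)))

    nonCrossing : NonCrossing n (merge q (suc (suc s)) (suc s))
    nonCrossing = nonCrossing-merge nc ≤-refl (≤-trans (n≤1+n (suc s)) (n≤1+n (suc (suc s))))
      (s≤s z≤n) s+2≤n (s≤s z≤n) (≤-trans (n≤1+n (suc s)) s+2≤n)

    nonSingle : ∀ j → 1 ≤ j → j ≤ t → ¬ Singleton n (merge q (suc (suc s)) (suc s)) j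
    nonSingle j 1≤j j≤t with partner q (nonSingleton j 1≤j (≤-trans j≤t t≤s+1))
    ... | y , 1≤y , y≤n , y≢j , qyj = partner⇒nonSingleton 1≤y y≤n y≢j (merge-cong qyj)

    unmerged : ∀ {j} → 1 ≤ j → j ≤ s → ¬ Merged j
    unmerged {j} 1≤j j≤s (inj₁ qj≡) = <⇒≢ (≤-trans (s≤s j≤s) (n≤1+n (suc s)))
      (distinct-inj 1≤j (s≤s z≤n) (≤-trans j≤s (≤-trans s≤t (n≤1+n t))) s+2≤t+1 qj≡)
    unmerged {j} 1≤j j≤s (inj₂ qj≡) = <⇒≢ (s≤s j≤s)
      (distinct-inj 1≤j (s≤s z≤n) (≤-trans j≤s (≤-trans s≤t (n≤1+n t))) (s≤s s≤t) qj≡)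

    separated : ∀ j k → 1 ≤ j → j < k → k ≤ r / 2 + 1 →
      merge q (suc (suc s)) (suc s) j ≢ merge q (suc (suc s)) (suc s) k
    separated j k 1≤j j<k k≤ e with merge-sameBlock e
    ... | inj₁ qjk = distinct j k 1≤j j<k (≤-trans (subst (k ≤_) s+1≡ k≤) (s≤s s≤t)) qjk
    ... | inj₂ (mj , _) = unmerged 1≤j (≤-pred (≤-trans j<k (subst (k ≤_) s+1≡ k≤))) mj

g-low : ∀ r i q → i ≤ r / 2 → g r i q ≡ gLow r i q
g-low r i q i≤s = cong (λ b → if b then gLow r i q else gTop r q) (dec-true (i ≤? r / 2) i≤s)

g-top : ∀ r q → g r (r / 2 + 1) q ≡ gTop r q
g-top r q = cong (λ b → if b then gLow r (r / 2 + 1) q else gTop r q)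
  (dec-false (r / 2 + 1 ≤? r / 2) (λ le → 1+n≰n (subst (_≤ r / 2) (+-comm (r / 2) 1) le)))

lemma5p29 : (n r : ℕ) (q : ℕ → ℕ) → suc r < n → W n (suc r) q →
    (∀ i → 1 ≤ i → i ≤ r / 2 + 1 → W n r (f r i q))
    × (∀ i → 1 ≤ i → i ≤ r / 2 → W n r (g r i q))
    × (r % 2 ≡ 1 → W n r (g r (r / 2 + 1) q))
lemma5p29 n r q r+1<n q∈W = f∈W , g∈W , gTop∈W
  where
  open Setting n r q r+1<n q∈W
  f∈W : ∀ i → 1 ≤ i → i ≤ r / 2 + 1 → W n r (f r i q)
  f∈W i 1≤i i≤ = Window.f-W i 1≤i (subst (i ≤_) s+1≡ i≤)
  g∈W : ∀ i → 1 ≤ i → i ≤ r / 2 → W n r (g r i q)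
  g∈W i 1≤i i≤s = subst (W n r) (sym (g-low r i q i≤s)) (Window.gLow-W i 1≤i (m≤n⇒m≤1+n i≤s) i≤s)
  gTop∈W : r % 2 ≡ 1 → W n r (g r (r / 2 + 1) q)
  gTop∈W r%2≡1 = subst (W n r) (sym (g-top r q)) (gTop-W (cong (_≡ᵇ 1) r%2≡1))
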